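{- Let $G$ be a finite abelian group, $A$ a finite label set, $B\subseteq A$, and $\eta\in\{0,1\}^B$. Then (i) for every integer $l\ge -1$, $\{p\circ s_B^\eta: p\in\mathcal{P}^{A,l}(G)\}=\mathcal{P}^{A\setminus B,l}(G)$; (ii) for every integer $l\ge |B|-1$, $\delta_B(\mathcal{P}^{A,l}(G))=\mathcal{P}^{A\setminus B,l-|B|}(G)$.
   Context: For $\omega\in\{0,1\}^A$, $|\omega|=\sum_j\omega_j$; identify $\{0,1\}^A=\{0,1\}^{A\setminus B}\times\{0,1\}^B$, $\omega=(\omega'',\eta)$. An $A$-cube in $G$ is a map $p:\{0,1\}^A\to G$; these form the group $G^{\{0,1\}^A}$ under pointwise addition. The inclusion $s_B^\eta:\{0,1\}^{A\setminus B}\to\{0,1\}^A$ is $\omega''\mapsto(\omega'',\eta)$, so $p\circ s_B^\eta$ is the restriction of $p$ to a face. The boundary operator $\delta_B:G^{\{0,1\}^A}\to G^{\{0,1\}^{A\setminus B}}$ is $(\delta_Bp)(\omega'')=\sum_{\eta\in\{0,1\}^B}(-1)^{|\eta|}p(\omega'',\eta)$ ($\delta_\emptyset=\mathrm{id}$). For a finite label set $A'$ with $d'=|A'|$: for $-1\le m\le d'-1$, $\mathcal{P}^{A',m}(G)=\bigcap_{C\subseteq A',|C|=m+1}\ker\delta_C$, and for $m\ge d'$, $\mathcal{P}^{A',m}(G)=G^{\{0,1\}^{A'}}$. -}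

module Defs where

open import Level using (_⊔_)
open import Algebra.Bundles using (AbelianGroup)
open import Data.Bool using (Bool; true; false)
open import Data.Nat using (ℕ; zero; suc)
open import Data.Integer using (ℤ; +_; _<_) renaming (_+_ to _+ℤ_)
open import Relation.Binary.PropositionalEquality using (_≡_)
open import Data.Fin using (Fin)
open import Data.Fin.Subset using (Subset)
open import Data.Vec using (Vec; []; _∷_)
open import Data.List using (List; _++_; map; foldr) renaming ([] to []ₗ; _∷_ to _∷ₗ_)
open import Data.Product using (Σ; ∃)

-- Labels: a finite label set A of size d is modelled as Fin d;
-- a subset B ⊆ A is a Subset d (true = inside B).
-- nIn B = |B|, nOut B = |A \ B|.
nIn : ∀ {d} → Subset d → ℕ
nIn [] = 0
nIn (true ∷ B) = suc (nIn B)
nIn (false ∷ B) = nIn B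

nOut : ∀ {d} → Subset d → ℕ
nOut [] = 0
nOut (true ∷ B) = nOut B
nOut (false ∷ B) = suc (nOut B)

weight : ∀ {k} → Vec Bool k → ℕ
weight [] = 0
weight (true ∷ w) = suc (weight w)
weight (false ∷ w) = weight w

-- the identification {0,1}^(A\B) × {0,1}^B ≅ {0,1}^A : (ω'' , η) ↦ ω
-- (complement coordinates and B-coordinates listed in increasing label order)
merge : ∀ {d} (B : Subset d) → Vec Bool (nOut B) → Vec Bool (nIn B) → Vec Bool d
merge [] [] [] = []
merge (true ∷ B) ω (b ∷ η) = b ∷ merge B ω η
merge (false ∷ B) (b ∷ ω) η = b ∷ merge B ω η

allVecs : (k : ℕ) → List (Vec Bool k)
allVecs zero = [] ∷ₗ []ₗ
allVecs (suc k) = map (false ∷_) (allVecs k) ++ map (true ∷_) (allVecs k)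

module Cubes {c ℓ} (G : AbelianGroup c ℓ) where
  open AbelianGroup G

  Finite : Set (c ⊔ ℓ)
  Finite = Σ ℕ λ n → Σ (Fin n → Carrier) λ f → ∀ x → ∃ λ i → f i ≈ x

  Cube : ℕ → Set c
  Cube k = Vec Bool k → Carrier

  signed : ℕ → Carrier → Carrier
  signed zero x = x
  signed (suc n) x = (signed n x) ⁻¹

  restrict : ∀ {d} (B : Subset d) → Vec Bool (nIn B) → Cube d → Cube (nOut B)
  restrict B η p ω = p (merge B ω η)

  δ : ∀ {d} (B : Subset d) → Cube d → Cube (nOut B)
  δ B p ω = foldr (λ η acc → signed (weight η) (p (merge B ω η)) ∙ acc) ε (allVecs (nIn B))

  -- membership in 𝒫^{A',m}(G) for A' = Fin d' (m ≥ -1 assumed by callers):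
  -- if m ≤ d'-1: in the intersection of ker δ_C over |C| = m+1; if m ≥ d': everything.
  InP : (d : ℕ) → ℤ → Cube d → Set ℓ
  InP d m p = m < + d → ∀ (C : Subset d) → + nIn C ≡ m +ℤ + 1 → ∀ ω → δ C p ω ≈ ε

-- Iterating the first difference Δ p = p(0,·) − p(1,·) over the labels of B computes δ_B,
-- and p ∈ 𝒫^{A,k-1} says that all such iterated differences of order k vanish. This class
-- is characterised label by label: p belongs to it iff both slices p(0,·), p(1,·) belong to
-- the class of order k and (for k ≥ 1) Δ p to that of order k - 1. Restriction to a face only fixes
-- coordinates and δ_B only takes |B| differences, so both preserve the classes with the
-- expected shift of order. For surjectivity, a q on {0,1}^(A∖B) is extended constantly in
-- the labels of B (whose face at η is q), and, for δ_B, by ε off the face η = 0 (whose δ_B is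
-- q); the latter raises the order by exactly one per label of B.

module Submission where

open import Defs
open import Algebra.Bundles using (AbelianGroup)
open import Data.Bool using (Bool)
open import Data.Nat using (ℕ)
open import Data.Integer using (ℤ; +_; -[1+_]; _≤_; _-_)
open import Data.Fin.Subset using (Subset)
open import Data.Vec using (Vec)
open import Data.Product using (_×_; ∃)

open import Data.Bool using (true; false)
open import Data.Nat as ℕ using (zero; suc; z≤n; s≤s)
open import Data.Nat.Properties using (m≤n⇒m≤1+n; m+[n∸m]≡n; +-suc; suc-injective)
open import Data.Integer using (_+_; _<_; ∣_∣; +≤+)
open import Data.Integer.Properties
  using (+-injective; +-comm; +-monoˡ-≤; ≤-trans; drop‿+≤+; 0≤i⇒+∣i∣≡i; suc[i]≤j⇒i<j)
open import Data.Integer.Tactic.RingSolver using (solve-∀)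
open import Data.Vec using ([]; _∷_)
open import Data.List using (List; _++_; map; foldr) renaming ([] to []ₗ; _∷_ to _∷ₗ_)
open import Data.Product using (_,_)
open import Relation.Binary.PropositionalEquality as P using (_≡_)
import Algebra.Properties.AbelianGroup as AbelianGroupProperties
import Algebra.Properties.CommutativeSemigroup as CommutativeSemigroupProperties

nIn≤ : ∀ {d} (C : Subset d) → nIn C ℕ.≤ d
nIn≤ []          = z≤n
nIn≤ (true ∷ C)  = s≤s (nIn≤ C)
nIn≤ (false ∷ C) = m≤n⇒m≤1+n (nIn≤ C)

[b-1]+1≡b : ∀ b → (b - + 1) + + 1 ≡ b
[b-1]+1≡b = solve-∀

[l-b]+1≡[l+1]-b : ∀ l b → (l - b) + + 1 ≡ (l + + 1) - b
[l-b]+1≡[l+1]-b = solve-∀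

[b+j]-b≡j : ∀ b j → (b + j) - b ≡ j
[b+j]-b≡j = solve-∀

-- An order m ≥ -1 of 𝒫^{A,m} is handled through the natural number m + 1.
level-split : ∀ b {l} → + b - + 1 ≤ l →
              ∃ λ j → + (b ℕ.+ j) ≡ l + + 1 × + j ≡ (l - + b) + + 1
level-split b {l} b-1≤l = j , b+j≡l+1 , j≡l-b+1
  where
  open P.≡-Reasoning
  b≤l+1 : + b ≤ l + + 1
  b≤l+1 = P.subst (_≤ l + + 1) ([b-1]+1≡b (+ b)) (+-monoˡ-≤ (+ 1) b-1≤l)
  k≡l+1 : + ∣ l + + 1 ∣ ≡ l + + 1
  k≡l+1 = 0≤i⇒+∣i∣≡i (≤-trans (+≤+ z≤n) b≤l+1)
  b≤k : b ℕ.≤ ∣ l + + 1 ∣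
  b≤k = drop‿+≤+ (P.subst (+ b ≤_) (P.sym k≡l+1) b≤l+1)
  j : ℕ
  j = ∣ l + + 1 ∣ ℕ.∸ b
  b+j≡l+1 : + (b ℕ.+ j) ≡ l + + 1
  b+j≡l+1 = P.trans (P.cong +_ (m+[n∸m]≡n b≤k)) k≡l+1
  j≡l-b+1 : + j ≡ (l - + b) + + 1
  j≡l-b+1 = begin
    + j                   ≡⟨ P.sym ([b+j]-b≡j (+ b) (+ j)) ⟩
    (+ b + + j) - + b     ≡⟨ P.cong (_- + b) b+j≡l+1 ⟩
    (l + + 1) - + b       ≡⟨ P.sym ([l-b]+1≡[l+1]-b l (+ b)) ⟩
    (l - + b) + + 1       ∎

below-dimension : ∀ {d} m (C : Subset d) → + nIn C ≡ m + + 1 → m < + d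
below-dimension {d} m C |C|≡m+1 =
  suc[i]≤j⇒i<j (P.subst (_≤ + d) (P.trans |C|≡m+1 (+-comm m (+ 1))) (+≤+ (nIn≤ C)))

module _ {c ℓ} (G : AbelianGroup c ℓ) where
  open AbelianGroup G renaming (_-_ to _//_)
  open Cubes G
  open AbelianGroupProperties G using (⁻¹-∙-comm; ε⁻¹≈ε; //-cong₂)
  open CommutativeSemigroupProperties commutativeSemigroup using (interchange)
  open import Relation.Binary.Reasoning.Setoid setoid

  infix  4 _≋_
  infixl 6 _⊟_

  _≋_ : ∀ {k} → Cube k → Cube k → Set ℓ
  p ≋ q = ∀ v → p v ≈ q v

  0̂ : ∀ {k} → Cube k
  0̂ _ = ε

  _⊟_ : ∀ {k} → Cube k → Cube k → Cube k
  (p ⊟ q) v = p v // q v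

  slice : ∀ {k} → Bool → Cube (suc k) → Cube k
  slice b p v = p (b ∷ v)

  Δ : ∀ {k} → Cube (suc k) → Cube k
  Δ p = slice false p ⊟ slice true p

  ∂ : ∀ {d} (B : Subset d) → Cube d → Cube (nOut B)
  ∂ []          p         = p
  ∂ (true ∷ B)  p         = ∂ B (Δ p)
  ∂ (false ∷ B) p (b ∷ ω) = ∂ B (slice b p) ω

  ⊟-cong : ∀ {k} {p p′ q q′ : Cube k} → p ≋ p′ → q ≋ q′ → p ⊟ q ≋ p′ ⊟ q′
  ⊟-cong p≋p′ q≋q′ v = //-cong₂ (p≋p′ v) (q≋q′ v)

  //-interchange : ∀ a b x y → (a // b) // (x // y) ≈ (a // x) // (b // y)
  //-interchange a b x y = begin
    (a // b) // (x // y)            ≈⟨ ∙-congˡ (⁻¹-∙-comm x (y ⁻¹)) ⟨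
    (a ∙ b ⁻¹) ∙ (x ⁻¹ ∙ y ⁻¹ ⁻¹)   ≈⟨ interchange a (b ⁻¹) (x ⁻¹) (y ⁻¹ ⁻¹) ⟩
    (a ∙ x ⁻¹) ∙ (b ⁻¹ ∙ y ⁻¹ ⁻¹)   ≈⟨ ∙-congˡ (⁻¹-∙-comm b (y ⁻¹)) ⟩
    (a // x) // (b // y)            ∎

  x//ε≈x : ∀ x → x // ε ≈ x
  x//ε≈x x = trans (∙-congˡ ε⁻¹≈ε) (identityʳ x)

  Δ-⊟ : ∀ {k} (p q : Cube (suc k)) → Δ (p ⊟ q) ≋ Δ p ⊟ Δ q
  Δ-⊟ p q v = //-interchange _ _ _ _

  Δ-0̂ : ∀ {k} {p : Cube (suc k)} → p ≋ 0̂ → Δ p ≋ 0̂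
  Δ-0̂ p≋0 v = trans (//-cong₂ (p≋0 _) (p≋0 _)) (inverseʳ ε)

  ∂-cong : ∀ {d} (B : Subset d) {p q : Cube d} → p ≋ q → ∂ B p ≋ ∂ B q
  ∂-cong []          p≋q       = p≋q
  ∂-cong (true ∷ B)  p≋q       = ∂-cong B (⊟-cong (λ v → p≋q (false ∷ v)) (λ v → p≋q (true ∷ v)))
  ∂-cong (false ∷ B) p≋q (b ∷ ω) = ∂-cong B (λ v → p≋q (b ∷ v)) ω

  ∂-⊟ : ∀ {d} (B : Subset d) (p q : Cube d) → ∂ B (p ⊟ q) ≋ ∂ B p ⊟ ∂ B q
  ∂-⊟ []          p q ω       = refl
  ∂-⊟ (true ∷ B)  p q ω       = trans (∂-cong B (Δ-⊟ p q) ω) (∂-⊟ B (Δ p) (Δ q) ω)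
  ∂-⊟ (false ∷ B) p q (b ∷ ω) = ∂-⊟ B (slice b p) (slice b q) ω

  ∂-0̂ : ∀ {d} (B : Subset d) {p : Cube d} → p ≋ 0̂ → ∂ B p ≋ 0̂
  ∂-0̂ []          p≋0         = p≋0
  ∂-0̂ (true ∷ B)  p≋0         = ∂-0̂ B (Δ-0̂ p≋0)
  ∂-0̂ (false ∷ B) p≋0 (b ∷ ω) = ∂-0̂ B (λ v → p≋0 (b ∷ v)) ω

  sumOver : ∀ {k} → (Vec Bool k → Carrier) → List (Vec Bool k) → Carrier
  sumOver f = foldr (λ η acc → f η ∙ acc) ε

  sumOver-++ : ∀ {k} (f : Vec Bool k → Carrier) xs ys →
               sumOver f (xs ++ ys) ≈ sumOver f xs ∙ sumOver f ys
  sumOver-++ f []ₗ       ys = sym (identityˡ _)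
  sumOver-++ f (x ∷ₗ xs) ys = trans (∙-congˡ (sumOver-++ f xs ys)) (sym (assoc _ _ _))

  sumOver-map : ∀ {k m} (f : Vec Bool k → Carrier) (g : Vec Bool m → Vec Bool k) xs →
                sumOver f (map g xs) ≡ sumOver (λ x → f (g x)) xs
  sumOver-map f g []ₗ       = P.refl
  sumOver-map f g (x ∷ₗ xs) = P.cong (f (g x) ∙_) (sumOver-map f g xs)

  sumOver-⁻¹ : ∀ {k} (f : Vec Bool k → Carrier) xs →
               sumOver (λ x → f x ⁻¹) xs ≈ sumOver f xs ⁻¹
  sumOver-⁻¹ f []ₗ       = sym ε⁻¹≈ε
  sumOver-⁻¹ f (x ∷ₗ xs) = trans (∙-congˡ (sumOver-⁻¹ f xs)) (⁻¹-∙-comm _ _)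

  -- Splitting {0,1}^B along its first label, the signs of the η with first bit 1 flip.
  δ-true : ∀ {d} (B : Subset d) (p : Cube (suc d)) →
           δ (true ∷ B) p ≋ δ B (slice false p) ⊟ δ B (slice true p)
  δ-true B p ω = begin
    sumOver f (map (false ∷_) ηs ++ map (true ∷_) ηs)
      ≈⟨ sumOver-++ f (map (false ∷_) ηs) (map (true ∷_) ηs) ⟩
    sumOver f (map (false ∷_) ηs) ∙ sumOver f (map (true ∷_) ηs)
      ≡⟨ P.cong₂ _∙_ (sumOver-map f (false ∷_) ηs) (sumOver-map f (true ∷_) ηs) ⟩
    δ B (slice false p) ω ∙ sumOver (λ η → f₁ η ⁻¹) ηs
      ≈⟨ ∙-congˡ (sumOver-⁻¹ f₁ ηs) ⟩
    δ B (slice false p) ω // δ B (slice true p) ω ∎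
    where
    ηs = allVecs (nIn B)
    f : Vec Bool (suc (nIn B)) → Carrier
    f η = signed (weight η) (p (merge (true ∷ B) ω η))
    f₁ : Vec Bool (nIn B) → Carrier
    f₁ η = signed (weight η) (p (true ∷ merge B ω η))

  δ≋∂ : ∀ {d} (B : Subset d) (p : Cube d) → δ B p ≋ ∂ B p
  δ≋∂ []          p []      = identityʳ _
  δ≋∂ (false ∷ B) p (b ∷ ω) = δ≋∂ B (slice b p) ω
  δ≋∂ (true ∷ B)  p ω       = begin
    δ (true ∷ B) p ω                                  ≈⟨ δ-true B p ω ⟩
    (δ B (slice false p) ⊟ δ B (slice true p)) ω      ≈⟨ ⊟-cong (δ≋∂ B _) (δ≋∂ B _) ω ⟩
    (∂ B (slice false p) ⊟ ∂ B (slice true p)) ω      ≈⟨ ∂-⊟ B _ _ ω ⟨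
    ∂ B (Δ p) ω                                       ∎

  -- Vanish k p is p ∈ 𝒫^{A,k-1}, stated with ∂ in place of δ.
  Vanish : ∀ {d} → ℕ → Cube d → Set ℓ
  Vanish k p = ∀ C → nIn C ≡ k → ∂ C p ≋ 0̂

  module _ {d k : ℕ} where

    Vanish-slice : ∀ {p : Cube (suc d)} b → Vanish k p → Vanish k (slice b p)
    Vanish-slice b vp C |C|≡k ω = vp (false ∷ C) |C|≡k (b ∷ ω)

    Vanish-Δ : ∀ {k′} {p : Cube (suc d)} → k ≡ suc k′ → Vanish k p → Vanish k′ (Δ p)
    Vanish-Δ P.refl vp C |C|≡k′ = vp (true ∷ C) (P.cong suc |C|≡k′)

    Vanish-intro : ∀ {p : Cube (suc d)} → (∀ b → Vanish k (slice b p)) →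
                   (∀ {k′} → k ≡ suc k′ → Vanish k′ (Δ p)) → Vanish k p
    Vanish-intro vs vΔ (false ∷ C) |C|≡k (b ∷ ω) = vs b C |C|≡k ω
    Vanish-intro vs vΔ (true ∷ C)  |C|≡k         = vΔ (P.sym |C|≡k) C P.refl

    Vanish-cong : ∀ {p q : Cube d} → p ≋ q → Vanish k p → Vanish k q
    Vanish-cong p≋q vp C |C|≡k ω = trans (sym (∂-cong C p≋q ω)) (vp C |C|≡k ω)

    Vanish-0̂ : ∀ {p : Cube d} → p ≋ 0̂ → Vanish k p
    Vanish-0̂ p≋0 C _ = ∂-0̂ C p≋0

    Vanish-⊟ : ∀ {p q : Cube d} → Vanish k p → Vanish k q → Vanish k (p ⊟ q)
    Vanish-⊟ {p} {q} vp vq C |C|≡k ω =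
      trans (∂-⊟ C p q ω) (trans (//-cong₂ (vp C |C|≡k ω) (vq C |C|≡k ω)) (inverseʳ ε))

  Vanish-zero⇒0̂ : ∀ {d} {p : Cube d} → Vanish 0 p → p ≋ 0̂
  Vanish-zero⇒0̂ {zero}  vp []      = vp [] P.refl []
  Vanish-zero⇒0̂ {suc d} vp (b ∷ v) = Vanish-zero⇒0̂ (Vanish-slice b vp) v

  -- Δ p lies in the same class as p, being a difference of two slices.
  Vanish-suc : ∀ {d k} {p : Cube d} → Vanish k p → Vanish (suc k) p
  Vanish-suc {zero}  vp [] ()
  Vanish-suc {suc d} vp = Vanish-intro (λ b → Vanish-suc (Vanish-slice b vp))
    λ { P.refl → Vanish-⊟ (Vanish-slice false vp) (Vanish-slice true vp) }

  restrict-Vanish : ∀ {d k} (B : Subset d) η {p : Cube d} → Vanish k p → Vanish k (restrict B η p)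
  restrict-Vanish []          []      vp [] |C|≡k [] = vp [] |C|≡k []
  restrict-Vanish (true ∷ B)  (b ∷ η) vp = restrict-Vanish B η (Vanish-slice b vp)
  restrict-Vanish (false ∷ B) η       vp = Vanish-intro
    (λ b → restrict-Vanish B η (Vanish-slice b vp))
    (λ k≡1+k′ → restrict-Vanish B η (Vanish-Δ k≡1+k′ vp))

  outside : ∀ {d} (B : Subset d) → Vec Bool d → Vec Bool (nOut B)
  outside []          []      = []
  outside (true ∷ B)  (b ∷ v) = outside B v
  outside (false ∷ B) (b ∷ v) = b ∷ outside B v

  outside-merge : ∀ {d} (B : Subset d) ω η → outside B (merge B ω η) ≡ ω
  outside-merge []          []      []      = P.refl
  outside-merge (true ∷ B)  ω       (b ∷ η) = outside-merge B ω η
  outside-merge (false ∷ B) (b ∷ ω) η       = P.cong (b ∷_) (outside-merge B ω η)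

  extend : ∀ {d} (B : Subset d) → Cube (nOut B) → Cube d
  extend B q v = q (outside B v)

  restrict-extend : ∀ {d} (B : Subset d) η (q : Cube (nOut B)) → restrict B η (extend B q) ≋ q
  restrict-extend B η q ω = reflexive (P.cong q (outside-merge B ω η))

  extend-Vanish : ∀ {d k} (B : Subset d) {q : Cube (nOut B)} → Vanish k q → Vanish k (extend B q)
  extend-Vanish []          vq [] |C|≡k [] = vq [] |C|≡k []
  extend-Vanish (true ∷ B)  vq = Vanish-intro
    (λ b → extend-Vanish B vq)
    (λ _ → Vanish-0̂ (λ v → inverseʳ _))
  extend-Vanish (false ∷ B) vq = Vanish-intro
    (λ b → extend-Vanish B (Vanish-slice b vq))
    (λ k≡1+k′ → extend-Vanish B (Vanish-Δ k≡1+k′ vq))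

  zeroExtend : ∀ {d} (B : Subset d) → Cube (nOut B) → Cube d
  zeroExtend []          q               = q
  zeroExtend (true ∷ B)  q (false ∷ v)   = zeroExtend B q v
  zeroExtend (true ∷ B)  q (true ∷ v)    = ε
  zeroExtend (false ∷ B) q (b ∷ v)       = zeroExtend B (slice b q) v

  zeroExtend-0̂ : ∀ {d} (B : Subset d) {q : Cube (nOut B)} → q ≋ 0̂ → zeroExtend B q ≋ 0̂
  zeroExtend-0̂ []          q≋0 = q≋0
  zeroExtend-0̂ (true ∷ B)  q≋0 (false ∷ v) = zeroExtend-0̂ B q≋0 v
  zeroExtend-0̂ (true ∷ B)  q≋0 (true ∷ v)  = refl
  zeroExtend-0̂ (false ∷ B) q≋0 (b ∷ v)     = zeroExtend-0̂ B (λ w → q≋0 (b ∷ w)) v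

  zeroExtend-⊟ : ∀ {d} (B : Subset d) (q q′ : Cube (nOut B)) →
                 zeroExtend B (q ⊟ q′) ≋ zeroExtend B q ⊟ zeroExtend B q′
  zeroExtend-⊟ []          q q′ v           = refl
  zeroExtend-⊟ (true ∷ B)  q q′ (false ∷ v) = zeroExtend-⊟ B q q′ v
  zeroExtend-⊟ (true ∷ B)  q q′ (true ∷ v)  = sym (inverseʳ ε)
  zeroExtend-⊟ (false ∷ B) q q′ (b ∷ v)     = zeroExtend-⊟ B (slice b q) (slice b q′) v

  ∂-zeroExtend : ∀ {d} (B : Subset d) (q : Cube (nOut B)) → ∂ B (zeroExtend B q) ≋ q
  ∂-zeroExtend []          q ω       = refl
  ∂-zeroExtend (true ∷ B)  q ω       =
    trans (∂-cong B (λ v → x//ε≈x (zeroExtend B q v)) ω) (∂-zeroExtend B q ω)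
  ∂-zeroExtend (false ∷ B) q (b ∷ ω) = ∂-zeroExtend B (slice b q) ω

  zeroExtend-Vanish : ∀ {d} j (B : Subset d) {q : Cube (nOut B)} →
                      Vanish j q → Vanish (nIn B ℕ.+ j) (zeroExtend B q)
  zeroExtend-Vanish j       []          vq = vq
  zeroExtend-Vanish j       (true ∷ B)  vq = Vanish-intro
    (λ { false → Vanish-suc (zeroExtend-Vanish j B vq) ; true → Vanish-0̂ (λ _ → refl) })
    (λ { P.refl → Vanish-cong (λ v → sym (x//ε≈x _)) (zeroExtend-Vanish j B vq) })
  zeroExtend-Vanish zero    (false ∷ B) {q} vq = Vanish-intro
    (λ b → zeroExtend-Vanish zero B (Vanish-slice b vq))
    (λ _ → Vanish-0̂ (Δ-0̂ (zeroExtend-0̂ (false ∷ B) (Vanish-zero⇒0̂ vq))))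
  zeroExtend-Vanish (suc j) (false ∷ B) {q} vq = Vanish-intro
    (λ b → zeroExtend-Vanish (suc j) B (Vanish-slice b vq))
    (λ b+1+j≡1+k′ → P.subst (λ k → Vanish k _)
                      (suc-injective (P.trans (P.sym (+-suc (nIn B) j)) b+1+j≡1+k′))
                      (Vanish-cong (zeroExtend-⊟ B (slice false q) (slice true q))
                                   (zeroExtend-Vanish j B (Vanish-Δ P.refl vq))))

  ∂-Vanish : ∀ {d} j (B : Subset d) {p : Cube d} → Vanish (nIn B ℕ.+ j) p → Vanish j (∂ B p)
  ∂-Vanish j       []          vp = vp
  ∂-Vanish j       (true ∷ B)  vp = ∂-Vanish j B (Vanish-Δ P.refl vp)
  ∂-Vanish zero    (false ∷ B) vp = Vanish-intro (λ b → ∂-Vanish zero B (Vanish-slice b vp)) (λ ())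
  ∂-Vanish (suc j) (false ∷ B) {p} vp = Vanish-intro
    (λ b → ∂-Vanish (suc j) B (Vanish-slice b vp))
    (λ { P.refl → Vanish-cong (∂-⊟ B (slice false p) (slice true p))
                              (∂-Vanish j B (Vanish-Δ (+-suc (nIn B) j) vp)) })

  InP⇒Vanish : ∀ {d m k} (p : Cube d) → + k ≡ m + + 1 → InP d m p → Vanish k p
  InP⇒Vanish {m = m} p k≡m+1 p∈P C |C|≡k ω =
    trans (sym (δ≋∂ C p ω)) (p∈P (below-dimension m C |C|≡m+1) C |C|≡m+1 ω)
    where |C|≡m+1 = P.trans (P.cong +_ |C|≡k) k≡m+1

  Vanish⇒InP : ∀ {d m k} (p : Cube d) → + k ≡ m + + 1 → Vanish k p → InP d m p
  Vanish⇒InP p k≡m+1 vp _ C |C|≡m+1 ω =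
    trans (δ≋∂ C p ω) (vp C (+-injective (P.trans |C|≡m+1 (P.sym k≡m+1))) ω)

  module _ {d : ℕ} (B : Subset d) where

    restriction-image : ∀ (η : Vec Bool (nIn B)) (l : ℤ) → -[1+ 0 ] ≤ l →
      (∀ (p : Cube d) → InP d l p → InP (nOut B) l (restrict B η p))
      × (∀ (q : Cube (nOut B)) → InP (nOut B) l q →
          ∃ λ (p : Cube d) → InP d l p × (restrict B η p ≋ q))
    restriction-image η l -1≤l with level-split 0 -1≤l
    ... | k , k≡l+1 , _ =
      (λ p p∈P → Vanish⇒InP (restrict B η p) k≡l+1
                   (restrict-Vanish B η (InP⇒Vanish p k≡l+1 p∈P)))
      , (λ q q∈P → extend B q
                 , Vanish⇒InP (extend B q) k≡l+1 (extend-Vanish B (InP⇒Vanish q k≡l+1 q∈P))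
                 , restrict-extend B η q)

    boundary-image : ∀ (l : ℤ) → (+ nIn B) - (+ 1) ≤ l →
      (∀ (p : Cube d) → InP d l p → InP (nOut B) (l - (+ nIn B)) (δ B p))
      × (∀ (q : Cube (nOut B)) → InP (nOut B) (l - (+ nIn B)) q →
          ∃ λ (p : Cube d) → InP d l p × (δ B p ≋ q))
    boundary-image l b-1≤l with level-split (nIn B) b-1≤l
    ... | j , b+j≡l+1 , j≡l-b+1 =
      (λ p p∈P → Vanish⇒InP (δ B p) j≡l-b+1
                   (Vanish-cong (λ ω → sym (δ≋∂ B p ω))
                     (∂-Vanish j B (InP⇒Vanish p b+j≡l+1 p∈P))))
      , (λ q q∈P → zeroExtend B q
                 , Vanish⇒InP (zeroExtend B q) b+j≡l+1
                     (zeroExtend-Vanish j B (InP⇒Vanish q j≡l-b+1 q∈P))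
                 , λ ω → trans (δ≋∂ B _ ω) (∂-zeroExtend B q ω))

proposition2p3 : ∀ {c ℓ} (G : AbelianGroup c ℓ) → Cubes.Finite G →
  (d : ℕ) (B : Subset d) (η : Vec Bool (nIn B)) →
  (∀ (l : ℤ) → -[1+ 0 ] ≤ l →
    (∀ (p : Cubes.Cube G d) → Cubes.InP G d l p → Cubes.InP G (nOut B) l (Cubes.restrict G B η p))
    × (∀ (q : Cubes.Cube G (nOut B)) → Cubes.InP G (nOut B) l q →
        ∃ λ (p : Cubes.Cube G d) → Cubes.InP G d l p
          × (∀ ω → AbelianGroup._≈_ G (Cubes.restrict G B η p ω) (q ω))))
  × (∀ (l : ℤ) → (+ nIn B) - (+ 1) ≤ l →
    (∀ (p : Cubes.Cube G d) → Cubes.InP G d l p → Cubes.InP G (nOut B) (l - (+ nIn B)) (Cubes.δ G B p))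
    × (∀ (q : Cubes.Cube G (nOut B)) → Cubes.InP G (nOut B) (l - (+ nIn B)) q →
        ∃ λ (p : Cubes.Cube G d) → Cubes.InP G d l p
          × (∀ ω → AbelianGroup._≈_ G (Cubes.δ G B p ω) (q ω))))
proposition2p3 G _ d B η = restriction-image G B η , boundary-image G B
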